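{- Let $L$ be a regular language and $\Delta$ a finite set of quantifier-free replacement queries. Then $(q_L,\Delta)$ can be maintained in $\mathrm{DynProp}$ with suitable initialization.
   Context: Strings over a finite alphabet $\Sigma$ are represented by databases with domain $\{1,\dots,n\}$, the natural linear order $<$, constants $\min=1$ and $\max=n$, and one unary relation $R_\sigma$ for each $\sigma\in\Sigma$, where each position is in at most one $R_\sigma$. Position $i$ carries $w_i=\sigma$ if $i\in R_\sigma$ and $w_i=\epsilon$ (empty word) if it is in no $R_\sigma$; the database represents the string $w_1\cdots w_n$. The order, $\min$ and $\max$ are never modified. $q_L$ is the Boolean query asking whether the represented string is in $L$. A replacement rule for $R_\sigma$ is $R_\sigma:=\mu_\sigma(\bar p;x)$ with $\mu_\sigma$ a formula over the string schema and $\bar p$ parameter variables; a replacement query $\rho(\bar p)$ is a set of such rules for distinct relations with the same parameters; it is quantifier-free if all $\mu_\sigma$ are. A change $\rho(\bar a)$ replaces each $R_\sigma$ having a rule by $\{b\mid\mathcal D\models\mu_\sigma(\bar a;b)\}$. Only replacement queries are considered whose application results in databases where every position is in at most one $R_\sigma$. Dynamic programs: states $(D,\mathcal I,\mathcal A)$ with input database $\mathcal I$ and auxiliary database $\mathcal A$ over the same fixed domain; for each $\rho\in\Delta$ and auxiliary relation $T$ an update formula $\varphi^\rho_T(\bar p;\bar x)$ over input and auxiliary schema; after change $\rho(\bar a)$ the input becomes $\rho(\bar a)(\mathcal I)$ and $T$ becomes $\{\bar b\mid(\mathcal I,\mathcal A)\models\varphi^\rho_T(\bar a;\bar b)\}$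 (old state). It maintains $(q_L,\Delta)$ if a designated nullary auxiliary relation $Q$ equals $q_L$ of the current input after every non-empty sequence of changes from $\Delta$ applied to the initial input database representing the empty string. $\mathrm{DynProp}$: quantifier-free update formulas. "With suitable initialization": the initial auxiliary relations need not be empty but may be set to suitable values depending on the domain. -}

module Defs where

open import Data.Nat using (ℕ; zero; suc; _+_; _<ᵇ_)
open import Data.Fin using (Fin; toℕ; fromℕ; _≟_)
open import Data.Bool using (Bool; true; false; not; _∧_; _∨_)
open import Data.Vec using (Vec; []; _∷_; lookup; _++_; map)
open import Data.List as List using (List; concatMap; filterᵇ; allFin; foldl; length)
open import Data.Maybe using (Maybe; just; nothing)
open import Data.Product using (Σ; _×_; _,_; proj₁; proj₂)
open import Relation.Nullary.Decidable using (isYes)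
open import Relation.Binary.PropositionalEquality using (_≡_; subst; sym)
open import Function.Bundles using (_⇔_)

Language : ℕ → Set₁
Language k = List (Fin k) → Set

record DFA (k : ℕ) : Set where
  field
    states : ℕ
    start  : Fin states
    δ      : Fin states → Fin k → Fin states
    accept : Fin states → Bool

accepts : ∀ {k} → DFA k → List (Fin k) → Bool
accepts A w = DFA.accept A (foldl (DFA.δ A) (DFA.start A) w)

Regular : ∀ {k} → Language k → Set
Regular {k} L = Σ (DFA k) λ A → (w : List (Fin k)) → L w ⇔ (accepts A w ≡ true)

data Term (v : ℕ) : Set where
  var : Fin v → Term v
  min : Term v
  max : Term v

data QF (k : ℕ) {m : ℕ} (ar : Fin m → ℕ) (v : ℕ) : Set where
  true'  : QF k ar v
  _=='_  : Term v → Term v → QF k ar v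
  _<'_   : Term v → Term v → QF k ar v
  R      : Fin k → Term v → QF k ar v
  aux    : (j : Fin m) → Vec (Term v) (ar j) → QF k ar v
  ¬'_    : QF k ar v → QF k ar v
  _∧'_   : QF k ar v → QF k ar v → QF k ar v
  _∨'_   : QF k ar v → QF k ar v → QF k ar v

noAux : Fin 0 → ℕ
noAux ()

-- databases over domain Fin (suc n) = {1,...,n+1}; min = first, max = last
Input : ℕ → ℕ → Set
Input k n = Fin k → Fin (suc n) → Bool

Aux : ∀ {m} → (Fin m → ℕ) → ℕ → Set
Aux {m} ar n = (j : Fin m) → Vec (Fin (suc n)) (ar j) → Bool

emptyAux : ∀ n → Aux noAux n
emptyAux n ()

evalT : ∀ {n v} → Vec (Fin (suc n)) v → Term v → Fin (suc n)
evalT env (var i) = lookup env i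
evalT env min = Fin.zero
evalT {n} env max = fromℕ n

eval : ∀ {k m n v} {ar : Fin m → ℕ} → QF k ar v → Input k n → Aux ar n
     → Vec (Fin (suc n)) v → Bool
eval true' I A env = true
eval (s ==' t) I A env = isYes (evalT env s ≟ evalT env t)
eval (s <' t) I A env = toℕ (evalT env s) <ᵇ toℕ (evalT env t)
eval (R σ t) I A env = I σ (evalT env t)
eval (aux j ts) I A env = A j (map (evalT env) ts)
eval (¬' φ) I A env = not (eval φ I A env)
eval (φ ∧' ψ) I A env = eval φ I A env ∧ eval ψ I A env
eval (φ ∨' ψ) I A env = eval φ I A env ∨ eval ψ I A env

Valid : ∀ {k n} → Input k n → Set
Valid {k} {n} I = (b : Fin (suc n)) (σ τ : Fin k) → I σ b ≡ true → I τ b ≡ true → σ ≡ τ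

word : ∀ {k n} → Input k n → List (Fin k)
word {k} {n} I = concatMap (λ b → filterᵇ (λ σ → I σ b) (allFin k)) (allFin (suc n))

emptyInput : ∀ k n → Input k n
emptyInput k n σ b = false

-- Quantifier-free replacement queries ρ(p̄): for each σ optionally a rule
-- R_σ := μ_σ(p̄; x), variables: p̄ = first `params` variables, x = last.

record ReplQuery (k : ℕ) : Set where
  field
    params : ℕ
    rule   : Fin k → Maybe (QF k noAux (params + 1))

applyρ : ∀ {k n} (ρ : ReplQuery k) → Vec (Fin (suc n)) (ReplQuery.params ρ)
       → Input k n → Input k n
applyρ {n = n} ρ a I σ b with ReplQuery.rule ρ σ
... | just μ  = eval μ I (emptyAux n) (a ++ (b ∷ []))
... | nothing = I σ b

PreservesValidity : ∀ {k} → List (ReplQuery k) → Set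
PreservesValidity {k} Δ = (i : Fin (length Δ)) (n : ℕ) (I : Input k n)
  (a : Vec (Fin (suc n)) (ReplQuery.params (List.lookup Δ i)))
  → Valid I → Valid (applyρ (List.lookup Δ i) a I)

record DynPropProg (k : ℕ) (Δ : List (ReplQuery k)) : Set where
  field
    m         : ℕ
    ar        : Fin m → ℕ
    Q         : Fin m
    Q-nullary : ar Q ≡ 0
    -- update formula φ^ρ_T(p̄; x̄): variables p̄ (first) then x̄
    update    : (i : Fin (length Δ)) (T : Fin m)
              → QF k ar (ReplQuery.params (List.lookup Δ i) + ar T)
    init      : (n : ℕ) → Aux ar n

module _ {k : ℕ} {Δ : List (ReplQuery k)} (P : DynPropProg k Δ) where
  open DynPropProg P

  Change : ℕ → Set
  Change n = Σ (Fin (length Δ)) λ i → Vec (Fin (suc n)) (ReplQuery.params (List.lookup Δ i))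

  State : ℕ → Set
  State n = Input k n × Aux ar n

  step : ∀ {n} → State n → Change n → State n
  step (I , A) (i , a) =
    applyρ (List.lookup Δ i) a I ,
    λ T b̄ → eval (update i T) I A (a ++ b̄)

  run : ∀ {n} → List (Change n) → State n
  run {n} cs = foldl step (emptyInput k n , init n) cs

  Qval : ∀ {n} → State n → Bool
  Qval (I , A) = A Q (subst (Vec _) (sym Q-nullary) [])

Maintains : ∀ {k} {Δ : List (ReplQuery k)} → DynPropProg k Δ → Language k → Set
Maintains {k} P L = (n : ℕ) (c : Change P n) (cs : List (Change P n))
  → (Qval P (run P (c List.∷ cs)) ≡ true) ⇔ L (word (proj₁ (run P (c List.∷ cs))))

-- A DFA D for L is simulated with, besides Q, one binary auxiliary relation T_{f,p,q}
-- for every substitution f of Σ ∪ {ε} and all states p, q: T_{f,p,q}(x, y) holds iff D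
-- moves from p to q on the letters strictly between x and y, each letter c read as f c.
-- A change ρ(ā) cuts the domain at the parameters ā. Inside one piece every atom of
-- μ_σ(ā; z) that involves z is decided by where the piece lies relative to ā, min and
-- max, and by the old letter c at z; so the new letter at z is h c for a substitution h
-- that quantifier-free formulas over ā compute. The new T_{f,p,q}(x, y) is therefore a
-- case distinction on the positions of the parameters relative to x and y: (x, y) is
-- split at every parameter inside it, the intermediate states are guessed, the new
-- letters at the parameters are read off directly and the pieces are looked up in the
-- old T_{f∘h,p′,q′}. Q is updated by the same computation over the whole string.

module Submission where

open import Defs
open import Data.Bool using (Bool; true; false; not; _∧_; _∨_; if_then_else_; T)
open import Data.Bool.ListAction using (any; or)
open import Data.Bool.Properties using (T-≡; T-∧; ∨-identityʳ; if-float; if-cong₂)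
open import Data.Empty using (⊥-elim)
open import Data.Fin as Fin
  using (Fin; zero; suc; toℕ; fromℕ; fromℕ<; _≟_; combine; quotient; remainder; funToFin; finToFun)
import Data.Fin.Properties as Finₚ
open import Data.List as List using (List; allFin; tabulate; filterᵇ; foldl)
import Data.List.Properties as ListP
open import Data.List.Membership.Propositional using (_∈_)
open import Data.List.Membership.Propositional.Properties using (∈-allFin)
open import Data.List.Relation.Unary.Any as Any using (here; there; satisfied)
open import Data.List.Relation.Unary.Any.Properties using (any⁺; any⁻)
open import Data.Maybe using (just; nothing; maybe)
open import Data.Nat as ℕ using (ℕ; zero; suc; _+_; _*_; _^_; _∸_; _<ᵇ_; _≤_; _<_)
import Data.Nat.Properties as ℕₚ
open import Data.Product using (Σ; _×_; _,_; proj₁; proj₂)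
open import Data.Sum using (_⊎_; inj₁; inj₂; [_,_]′)
open import Data.Unit using (tt)
open import Data.Vec using (Vec; []; _∷_; _++_; lookup)
open import Data.Vec.Functional using (updateAt) renaming (_∷_ to _∷ᶠ_)
open import Data.Vec.Functional.Properties using (updateAt-updates; updateAt-minimal)
open import Data.Vec.Properties using (lookup-splitAt; lookup-++ˡ; lookup-++ʳ)
open import Function using (_∘_; id; _⇔_; Equivalence; mk⇔)
open import Relation.Nullary using (yes; no)
open import Relation.Nullary.Decidable using (isYes; toWitness; fromWitness)
open import Relation.Binary.PropositionalEquality

open Equivalence using (to; from)

T-injective : ∀ {a b} → T a ⇔ T b → a ≡ b
T-injective {false} {false} _ = refl
T-injective {false} {true}  e = ⊥-elim (from e tt)
T-injective {true}  {false} e = ⊥-elim (to e tt)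
T-injective {true}  {true}  _ = refl

≟-refl : ∀ {n} (x : Fin n) → isYes (x ≟ x) ≡ true
≟-refl x with x ≟ x
... | yes _  = refl
... | no x≢x = ⊥-elim (x≢x refl)

≟-≢ : ∀ {n} {x y : Fin n} → x ≢ y → isYes (x ≟ y) ≡ false
≟-≢ {x = x} {y} x≢y with x ≟ y
... | yes x≡y = ⊥-elim (x≢y x≡y)
... | no _    = refl

<⇒<ᵇ≡true : ∀ {m n} → m < n → (m <ᵇ n) ≡ true
<⇒<ᵇ≡true m<n = to T-≡ (ℕₚ.<⇒<ᵇ m<n)

≥⇒<ᵇ≡false : ∀ {m n} → n ≤ m → (m <ᵇ n) ≡ false
≥⇒<ᵇ≡false {m} {n} n≤m with m <ᵇ n in m<ᵇn
... | true  = ⊥-elim (ℕₚ.<⇒≱ (ℕₚ.<ᵇ⇒< m n (from T-≡ m<ᵇn)) n≤m)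
... | false = refl

<ᵇ≡true⇒< : ∀ {m n} → (m <ᵇ n) ≡ true → m < n
<ᵇ≡true⇒< {m} {n} m<ᵇn = ℕₚ.<ᵇ⇒< m n (from T-≡ m<ᵇn)

<ᵇ≡false⇒≥ : ∀ {m n} → (m <ᵇ n) ≡ false → n ≤ m
<ᵇ≡false⇒≥ {m} {n} m≮ᵇn = ℕₚ.≮⇒≥ λ m<n → subst T m≮ᵇn (ℕₚ.<⇒<ᵇ m<n)

any-cong : ∀ {A : Set} {p q : A → Bool} → p ≗ q → ∀ xs → any p xs ≡ any q xs
any-cong p≗q xs = cong or (ListP.map-cong p≗q xs)

any-select : ∀ {n} (v : Fin n → Bool) (x₀ : Fin n)
           → any (λ x → isYes (x₀ ≟ x) ∧ v x) (allFin n) ≡ v x₀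
any-select v x₀ = T-injective (mk⇔ chosen witness)
  where
  chosen : T (any (λ x → isYes (x₀ ≟ x) ∧ v x) (allFin _)) → T (v x₀)
  chosen t with satisfied (any⁻ (λ x → isYes (x₀ ≟ x) ∧ v x) (allFin _) t)
  ... | x , px with to (T-∧ {isYes (x₀ ≟ x)}) px
  ...   | x₀≡x , vx = subst (T ∘ v) (sym (toWitness x₀≡x)) vx
  witness : T (v x₀) → T (any (λ x → isYes (x₀ ≟ x) ∧ v x) (allFin _))
  witness vx₀ = any⁺ _ (Any.map (λ { refl → from T-∧ (fromWitness refl , vx₀) }) (∈-allFin x₀))

foldl-concatMap : ∀ {X A B : Set} (h : X → B → X) (g : A → List B) s xs
                → foldl h s (List.concatMap g xs) ≡ foldl (λ t x → foldl h t (g x)) s xs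
foldl-concatMap h g s List.[]         = refl
foldl-concatMap h g s (x List.∷ xs) =
  trans (ListP.foldl-++ h s (g x) (List.concatMap g xs)) (foldl-concatMap h g (foldl h s (g x)) xs)

funToFin-cong : ∀ {m n} {f g : Fin m → Fin n} → f ≗ g → funToFin f ≡ funToFin g
funToFin-cong {zero}  f≗g = refl
funToFin-cong {suc m} f≗g = cong₂ combine (f≗g zero) (funToFin-cong (f≗g ∘ suc))

firstTrue : ∀ {d} → (Fin d → Bool) → Fin (suc d)
firstTrue {zero}  P = zero
firstTrue {suc d} P = if P zero then suc zero else Fin.lift 1 suc (firstTrue (P ∘ suc))

firstTrue-cong : ∀ {d} {P Q : Fin d → Bool} → P ≗ Q → firstTrue P ≡ firstTrue Q
firstTrue-cong {zero}          P≗Q = refl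
firstTrue-cong {suc d} {P} {Q} P≗Q rewrite P≗Q zero =
  cong (λ m → if Q zero then suc zero else Fin.lift 1 suc m) (firstTrue-cong (P≗Q ∘ suc))

AtMostOne : ∀ {d} → (Fin d → Bool) → Set
AtMostOne P = ∀ σ τ → P σ ≡ true → P τ ≡ true → σ ≡ τ

AtMostOne-suc : ∀ {d} {P : Fin (suc d) → Bool} → AtMostOne P → AtMostOne (P ∘ suc)
AtMostOne-suc u σ τ p q = Finₚ.suc-injective (u _ _ p q)

firstTrue-sound : ∀ {d} (P : Fin d → Bool) {σ} → firstTrue P ≡ suc σ → P σ ≡ true
firstTrue-sound {suc d} P eq with P zero in P₀
... | true = subst (λ τ → P τ ≡ true) (Finₚ.suc-injective eq) P₀
... | false with firstTrue (P ∘ suc) in e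
firstTrue-sound {suc d} P () | false | zero
firstTrue-sound {suc d} P refl | false | suc σ = firstTrue-sound (P ∘ suc) e

firstTrue-none : ∀ {d} (P : Fin d → Bool) → firstTrue P ≡ zero → ∀ σ → P σ ≡ false
firstTrue-none {suc d} P eq σ with P zero in P₀
firstTrue-none {suc d} P () σ | true
... | false with firstTrue (P ∘ suc) in e
firstTrue-none {suc d} P eq zero | false | zero = P₀
firstTrue-none {suc d} P eq (suc σ) | false | zero = firstTrue-none (P ∘ suc) e σ

firstTrue-unique : ∀ {d} (P : Fin d → Bool) → AtMostOne P
                 → ∀ τ → P τ ≡ isYes (firstTrue P ≟ suc τ)
firstTrue-unique P u τ with firstTrue P in e
... | zero = firstTrue-none P e τ
... | suc σ with σ ≟ τ
...   | yes refl = firstTrue-sound P e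
...   | no σ≢τ with P τ in Pτ
...     | true = ⊥-elim (σ≢τ (u σ τ (firstTrue-sound P e) Pτ))
...     | false = refl

letters : ∀ {d} → Fin (suc d) → List (Fin d)
letters zero    = List.[]
letters (suc σ) = σ List.∷ List.[]

filterᵇ-tabulate : ∀ {d} {A : Set} (P : A → Bool) (g : Fin d → A) → AtMostOne (P ∘ g)
                 → filterᵇ P (tabulate g) ≡ List.map g (letters (firstTrue (P ∘ g)))
filterᵇ-tabulate {zero} P g u = refl
filterᵇ-tabulate {suc d} P g u with P (g zero) in P₀
... | true = cong (g zero List.∷_)
  (trans (filterᵇ-tabulate P (g ∘ suc) (AtMostOne-suc u)) (cong (List.map (g ∘ suc) ∘ letters) none))
  where
  none : firstTrue (P ∘ g ∘ suc) ≡ zero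
  none with firstTrue (P ∘ g ∘ suc) in e
  ... | zero = refl
  ... | suc σ with () ← u zero (suc σ) P₀ (firstTrue-sound (P ∘ g ∘ suc) e)
... | false = trans (filterᵇ-tabulate P (g ∘ suc) (AtMostOne-suc u)) (shift (firstTrue (P ∘ g ∘ suc)))
  where
  shift : ∀ m → List.map (g ∘ suc) (letters m) ≡ List.map g (letters (Fin.lift 1 suc m))
  shift zero    = refl
  shift (suc σ) = refl

module _ {X : Set} where

  iterateFrom : (ℕ → X → X) → ℕ → ℕ → X → X
  iterateFrom G a zero    s = s
  iterateFrom G a (suc l) s = iterateFrom G (suc a) l (G a s)

  iterateFrom-+ : ∀ G a m l s → iterateFrom G a (m + l) s ≡ iterateFrom G (a + m) l (iterateFrom G a m s)
  iterateFrom-+ G a zero    l s rewrite ℕₚ.+-identityʳ a = refl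
  iterateFrom-+ G a (suc m) l s rewrite ℕₚ.+-suc a m = iterateFrom-+ G (suc a) m l (G a s)

  iterateFrom-cong : ∀ {G G′} a l s → (∀ m → a ≤ m → m < a + l → G m ≗ G′ m)
                   → iterateFrom G a l s ≡ iterateFrom G′ a l s
  iterateFrom-cong a zero    s G≗G′ = refl
  iterateFrom-cong {G} {G′} a (suc l) s G≗G′ =
    trans (cong (iterateFrom G (suc a) l) (G≗G′ a ℕₚ.≤-refl a<end s))
          (iterateFrom-cong (suc a) l (G′ a s) λ m a<m m<end →
             G≗G′ m (ℕₚ.<⇒≤ a<m) (subst (m <_) (sym (ℕₚ.+-suc a l)) m<end))
    where
    a<end : a < a + suc l
    a<end = subst (a <_) (sym (ℕₚ.+-suc a l)) (ℕₚ.m≤m+n (suc a) l)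

  iterateFrom-snoc : ∀ G a l s → iterateFrom G a (suc l) s ≡ G (a + l) (iterateFrom G a l s)
  iterateFrom-snoc G a zero    s = cong (λ b → G b s) (sym (ℕₚ.+-identityʳ a))
  iterateFrom-snoc G a (suc l) s =
    trans (iterateFrom-snoc G (suc a) l (G a s))
          (cong (λ b → G b (iterateFrom G (suc a) l (G a s))) (sym (ℕₚ.+-suc a l)))

  -- the positions x + 1, …, y - 1; none at all when y ≤ x + 1
  between : (ℕ → X → X) → ℕ → ℕ → X → X
  between G x y = iterateFrom G (suc x) (y ∸ suc x)

  between-cong : ∀ {G G′} x y s → (∀ m → x < m → m < y → G m ≗ G′ m)
               → between G x y s ≡ between G′ x y s
  between-cong x y s G≗G′ =
    iterateFrom-cong (suc x) (y ∸ suc x) s λ m x<m m<end → G≗G′ m x<m (below-end x<m m<end)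
    where
    below-end : ∀ {m} → x < m → m < suc x + (y ∸ suc x) → m < y
    below-end {m} x<m m<end with suc x ℕ.≤? y
    ... | yes x<y = subst (m <_) (ℕₚ.m+[n∸m]≡n x<y) m<end
    ... | no x≮y = ⊥-elim (ℕₚ.<⇒≱ m<end (subst (_≤ m) (sym empty) x<m))
      where
      empty : suc x + (y ∸ suc x) ≡ suc x
      empty = trans (cong (suc x +_) (ℕₚ.m≤n⇒m∸n≡0 (ℕₚ.<⇒≤ (ℕₚ.≰⇒> x≮y))))
                    (ℕₚ.+-identityʳ (suc x))

  iterateFrom-whole : ∀ G N s
                    → iterateFrom G 0 (suc N) s ≡ (if 0 <ᵇ N then G N (between G 0 N (G 0 s)) else G 0 s)
  iterateFrom-whole G zero    s = refl
  iterateFrom-whole G (suc N) s = iterateFrom-snoc G 1 N (G 0 s)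

  between-split : ∀ G {x e y} s → x < e → e < y → between G x y s ≡ between G e y (G e (between G x e s))
  between-split G {x} {e} {y} s x<e e<y = begin
    iterateFrom G (suc x) (y ∸ suc x) s
      ≡⟨ cong (λ l → iterateFrom G (suc x) l s) length ⟩
    iterateFrom G (suc x) ((e ∸ suc x) + suc (y ∸ suc e)) s
      ≡⟨ iterateFrom-+ G (suc x) (e ∸ suc x) _ s ⟩
    iterateFrom G (suc x + (e ∸ suc x)) (suc (y ∸ suc e)) (between G x e s)
      ≡⟨ cong (λ a → iterateFrom G a (suc (y ∸ suc e)) (between G x e s)) (ℕₚ.m+[n∸m]≡n x<e) ⟩
    between G e y (G e (between G x e s)) ∎
    where
    open ≡-Reasoning
    length : y ∸ suc x ≡ (e ∸ suc x) + suc (y ∸ suc e)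
    length = begin
      y ∸ suc x                                             ≡⟨ cong (_∸ suc x) whole ⟨
      suc x + ((e ∸ suc x) + suc (y ∸ suc e)) ∸ suc x       ≡⟨ ℕₚ.m+n∸m≡n (suc x) _ ⟩
      (e ∸ suc x) + suc (y ∸ suc e)                         ∎
      where
      whole : suc x + ((e ∸ suc x) + suc (y ∸ suc e)) ≡ y
      whole = begin
        suc x + ((e ∸ suc x) + suc (y ∸ suc e))  ≡⟨ ℕₚ.+-assoc (suc x) _ _ ⟨
        suc x + (e ∸ suc x) + suc (y ∸ suc e)    ≡⟨ cong (_+ suc (y ∸ suc e)) (ℕₚ.m+[n∸m]≡n x<e) ⟩
        e + suc (y ∸ suc e)                      ≡⟨ ℕₚ.+-suc e _ ⟩
        suc e + (y ∸ suc e)                      ≡⟨ ℕₚ.m+[n∸m]≡n e<y ⟩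
        y                                        ∎

foldl-tabulate : ∀ {X A : Set} {N} (F : X → A → X) (g : Fin N → A) (G : ℕ → X → X) a s
               → (∀ i t → G (a + toℕ i) t ≡ F t (g i))
               → foldl F s (tabulate g) ≡ iterateFrom G a N s
foldl-tabulate {N = zero}  F g G a s G≡F = refl
foldl-tabulate {N = suc N} F g G a s G≡F = begin
  foldl F (F s (g zero)) (tabulate (g ∘ suc))
    ≡⟨ cong (λ t → foldl F t (tabulate (g ∘ suc))) first ⟨
  foldl F (G a s) (tabulate (g ∘ suc))
    ≡⟨ foldl-tabulate F (g ∘ suc) G (suc a) (G a s) rest ⟩
  iterateFrom G (suc a) N (G a s) ∎
  where
  open ≡-Reasoning
  first : G a s ≡ F s (g zero)
  first = subst (λ b → G b s ≡ F s (g zero)) (ℕₚ.+-identityʳ a) (G≡F zero s)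
  rest : ∀ i t → G (suc a + toℕ i) t ≡ F t (g (suc i))
  rest i t = subst (λ b → G b t ≡ F t (g (suc i))) (ℕₚ.+-suc a (toℕ i)) (G≡F (suc i) t)

module _ {k m : ℕ} {ar : Fin m → ℕ} {v : ℕ} where

  ⊥ᶠ : QF k ar v
  ⊥ᶠ = ¬' true'

  constᶠ : Bool → QF k ar v
  constᶠ b = if b then true' else ⊥ᶠ

  ite : QF k ar v → QF k ar v → QF k ar v → QF k ar v
  ite g φ ψ = (g ∧' φ) ∨' ((¬' g) ∧' ψ)

  ⋁ : ∀ {d} → (Fin d → QF k ar v) → QF k ar v
  ⋁ φ = List.foldr (λ i ψ → φ i ∨' ψ) ⊥ᶠ (allFin _)

  bindFirst : ∀ {d} → (Fin d → QF k ar v) → (Fin (suc d) → QF k ar v) → QF k ar v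
  bindFirst {zero}  P ψ = ψ zero
  bindFirst {suc d} P ψ = ite (P zero) (ψ (suc zero)) (bindFirst (P ∘ suc) (ψ ∘ Fin.lift 1 suc))

  bindFirstEach : ∀ {c d} → (Fin c → Fin d → QF k ar v) → ((Fin c → Fin (suc d)) → QF k ar v)
                → QF k ar v
  bindFirstEach {zero}  P ψ = ψ λ ()
  bindFirstEach {suc c} P ψ = bindFirst (P zero) λ a → bindFirstEach (P ∘ suc) (ψ ∘ (a ∷ᶠ_))

  module Eval {n} (I : Input k n) (A : Aux ar n) (env : Vec (Fin (suc n)) v) where

    ⟦_⟧ : QF k ar v → Bool
    ⟦ φ ⟧ = eval φ I A env

    ⟦constᶠ⟧ : ∀ b → ⟦ constᶠ b ⟧ ≡ b
    ⟦constᶠ⟧ true  = refl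
    ⟦constᶠ⟧ false = refl

    ⟦ite⟧ : ∀ g φ ψ → ⟦ ite g φ ψ ⟧ ≡ (if ⟦ g ⟧ then ⟦ φ ⟧ else ⟦ ψ ⟧)
    ⟦ite⟧ g φ ψ with ⟦ g ⟧
    ... | true  = ∨-identityʳ ⟦ φ ⟧
    ... | false = refl

    ⟦⋁⟧ : ∀ {d} (φ : Fin d → QF k ar v) → ⟦ ⋁ φ ⟧ ≡ any (⟦_⟧ ∘ φ) (allFin d)
    ⟦⋁⟧ φ = go (allFin _)
      where
      go : ∀ is → ⟦ List.foldr (λ i ψ → φ i ∨' ψ) ⊥ᶠ is ⟧ ≡ any (⟦_⟧ ∘ φ) is
      go List.[]       = refl
      go (i List.∷ is) = cong (⟦ φ i ⟧ ∨_) (go is)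

    ⟦bindFirst⟧ : ∀ {d} (P : Fin d → QF k ar v) ψ → ⟦ bindFirst P ψ ⟧ ≡ ⟦ ψ (firstTrue (⟦_⟧ ∘ P)) ⟧
    ⟦bindFirst⟧ {zero}  P ψ = refl
    ⟦bindFirst⟧ {suc d} P ψ =
      trans (⟦ite⟧ (P zero) (ψ (suc zero)) (bindFirst (P ∘ suc) (ψ ∘ Fin.lift 1 suc))) (branch ⟦ P zero ⟧)
      where
      branch : ∀ b → (if b then ⟦ ψ (suc zero) ⟧ else ⟦ bindFirst (P ∘ suc) (ψ ∘ Fin.lift 1 suc) ⟧)
                  ≡ ⟦ ψ (if b then suc zero else Fin.lift 1 suc (firstTrue (⟦_⟧ ∘ P ∘ suc))) ⟧
      branch true  = refl
      branch false = ⟦bindFirst⟧ (P ∘ suc) (ψ ∘ Fin.lift 1 suc)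

    ⟦bindFirstEach⟧ : ∀ {c d} (P : Fin c → Fin d → QF k ar v) ψ
                    → (∀ {g g′} → g ≗ g′ → ⟦ ψ g ⟧ ≡ ⟦ ψ g′ ⟧)
                    → ⟦ bindFirstEach P ψ ⟧ ≡ ⟦ ψ (λ i → firstTrue (⟦_⟧ ∘ P i)) ⟧
    ⟦bindFirstEach⟧ {zero}  P ψ ψ-cong = ψ-cong λ ()
    ⟦bindFirstEach⟧ {suc c} P ψ ψ-cong =
      trans (⟦bindFirst⟧ (P zero) _)
            (trans (⟦bindFirstEach⟧ (P ∘ suc) _ (λ g≗g′ → ψ-cong λ { zero → refl ; (suc i) → g≗g′ i }))
                   (ψ-cong λ { zero → refl ; (suc i) → refl }))

-- A term of a rule μ(p̄; x) denotes a parameter, min or max (an anchor) or the position x.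
data Anchor (r : ℕ) : Set where
  parameter   : Fin r → Anchor r
  first last  : Anchor r

data Role (r : ℕ) : Set where
  anchor : Anchor r → Role r
  point  : Role r

role : ∀ {r} → Term (r + 1) → Role r
role {r} (var i) = [ anchor ∘ parameter , (λ _ → point) ]′ (Fin.splitAt r i)
role min         = anchor first
role max         = anchor last

module _ {n r : ℕ} (a : Vec (Fin (suc n)) r) where

  anchorAt : Anchor r → Fin (suc n)
  anchorAt (parameter i) = lookup a i
  anchorAt first         = zero
  anchorAt last          = fromℕ n

  roleAt : Fin (suc n) → Role r → Fin (suc n)
  roleAt z (anchor α) = anchorAt α
  roleAt z point      = z

  evalT-role : ∀ z t → evalT (a ++ z ∷ []) t ≡ roleAt z (role t)
  evalT-role z (var i) rewrite lookup-splitAt r a (z ∷ []) i with Fin.splitAt r i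
  ... | inj₁ j    = refl
  ... | inj₂ zero = refl
  evalT-role z min = refl
  evalT-role z max = refl

record Atoms (k r : ℕ) {m : ℕ} (ar : Fin m → ℕ) (v : ℕ) : Set where
  field
    equal less : Role r → Role r → QF k ar v
    holds      : Fin k → Role r → QF k ar v

module _ {k r m v : ℕ} {ar : Fin m → ℕ} (α : Atoms k r ar v) where
  open Atoms α

  translate : QF k noAux (r + 1) → QF k ar v
  translate true'      = true'
  translate (s ==' t)  = equal (role s) (role t)
  translate (s <' t)   = less (role s) (role t)
  translate (R σ t)    = holds σ (role t)
  translate (aux () _)
  translate (¬' φ)     = ¬' translate φ
  translate (φ ∧' ψ)   = translate φ ∧' translate ψ
  translate (φ ∨' ψ)   = translate φ ∨' translate ψ

  module _ {n} (I : Input k n) (A : Aux ar n) (env : Vec (Fin (suc n)) v)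
           (a : Vec (Fin (suc n)) r) (z : Fin (suc n)) where
    open Eval I A env

    record Sound : Set where
      field
        equal-sound : ∀ u u′ → ⟦ equal u u′ ⟧ ≡ isYes (roleAt a z u ≟ roleAt a z u′)
        less-sound  : ∀ u u′ → ⟦ less u u′ ⟧ ≡ (toℕ (roleAt a z u) <ᵇ toℕ (roleAt a z u′))
        holds-sound : ∀ σ u → ⟦ holds σ u ⟧ ≡ I σ (roleAt a z u)

    ⟦translate⟧ : Sound → ∀ μ → ⟦ translate μ ⟧ ≡ eval μ I (emptyAux n) (a ++ z ∷ [])
    ⟦translate⟧ sound true'      = refl
    ⟦translate⟧ sound (s ==' t)  rewrite evalT-role a z s | evalT-role a z t =
      Sound.equal-sound sound (role s) (role t)
    ⟦translate⟧ sound (s <' t)   rewrite evalT-role a z s | evalT-role a z t =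
      Sound.less-sound sound (role s) (role t)
    ⟦translate⟧ sound (R σ t)    rewrite evalT-role a z t =
      Sound.holds-sound sound σ (role t)
    ⟦translate⟧ sound (aux () _)
    ⟦translate⟧ sound (¬' φ)     = cong not (⟦translate⟧ sound φ)
    ⟦translate⟧ sound (φ ∧' ψ)   = cong₂ _∧_ (⟦translate⟧ sound φ) (⟦translate⟧ sound ψ)
    ⟦translate⟧ sound (φ ∨' ψ)   = cong₂ _∨_ (⟦translate⟧ sound φ) (⟦translate⟧ sound ψ)

newRule : ∀ {k} (ρ : ReplQuery k) → Fin k → QF k noAux (ReplQuery.params ρ + 1)
newRule ρ σ = maybe id (R σ (var (ReplQuery.params ρ Fin.↑ʳ zero))) (ReplQuery.rule ρ σ)

eval-newRule : ∀ {k n} (ρ : ReplQuery k) (a : Vec (Fin (suc n)) (ReplQuery.params ρ)) (I : Input k n) σ z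
             → eval (newRule ρ σ) I (emptyAux n) (a ++ z ∷ []) ≡ applyρ ρ a I σ z
eval-newRule ρ a I σ z with ReplQuery.rule ρ σ
... | just μ  = refl
... | nothing = cong (I σ) (lookup-++ʳ a (z ∷ []) zero)

-- The dynamic program for a DFA

module Construction {k : ℕ} (D : DFA k) where
  open DFA D using (states; start; δ; accept)

  -- zero stands for ε
  Letter : Set
  Letter = Fin (suc k)

  Subst : Set
  Subst = Letter → Letter

  δ̂ : Fin states → Letter → Fin states
  δ̂ s zero    = s
  δ̂ s (suc σ) = δ s σ

  Code : ℕ
  Code = (suc k ^ suc k) * (states * states)

  arity : Fin (suc Code) → ℕ
  arity zero    = 0
  arity (suc _) = 2

  code : Subst → Fin states → Fin states → Fin Code
  code f p q = combine (funToFin f) (combine p q)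

  T⟨_,_,_⟩ : Subst → Fin states → Fin states → Fin (suc Code)
  T⟨ f , p , q ⟩ = suc (code f p q)

  substOf : Fin Code → Subst
  substOf j = finToFun (quotient {suc k ^ suc k} (states * states) j)

  sourceOf targetOf : Fin Code → Fin states
  sourceOf j = quotient {states} states (remainder {suc k ^ suc k} (states * states) j)
  targetOf j = remainder {states} states (remainder {suc k ^ suc k} (states * states) j)

  code-cong : ∀ {f g} → f ≗ g → ∀ p q → code f p q ≡ code g p q
  code-cong f≗g p q = cong (λ c → combine c (combine p q)) (funToFin-cong f≗g)

  decode : ∀ f p q → (substOf (code f p q) ≗ f) × sourceOf (code f p q) ≡ p × targetOf (code f p q) ≡ q
  decode f p q =
      (λ c → trans (cong (λ g → finToFun g c) (cong proj₁ outer)) (Finₚ.finToFun-funToFin f c))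
    , trans (cong (quotient {states} states ∘ proj₂) outer) (cong proj₁ (Finₚ.remQuot-combine p q))
    , trans (cong (remainder {states} states ∘ proj₂) outer) (cong proj₂ (Finₚ.remQuot-combine p q))
    where
    outer : Fin.remQuot {suc k ^ suc k} (states * states) (code f p q) ≡ (funToFin f , combine p q)
    outer = Finₚ.remQuot-combine {suc k ^ suc k} {states * states} (funToFin f) (combine p q)

  module _ {n : ℕ} (I : Input k n) where

    letterAt : Fin (suc n) → Letter
    letterAt z = firstTrue (λ σ → I σ z)

    -- ε outside the domain
    letterAtℕ : ℕ → Letter
    letterAtℕ m with m ℕ.<? suc n
    ... | yes m<1+n = letterAt (fromℕ< m<1+n)
    ... | no _      = zero

    letterAtℕ-fromℕ< : ∀ {m} (m<1+n : m < suc n) → letterAtℕ m ≡ letterAt (fromℕ< m<1+n)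
    letterAtℕ-fromℕ< {m} m<1+n with m ℕ.<? suc n
    ... | yes _      = refl
    ... | no m≮1+n   = ⊥-elim (m≮1+n m<1+n)

    letterAtℕ-toℕ : ∀ z → letterAtℕ (toℕ z) ≡ letterAt z
    letterAtℕ-toℕ z = trans (letterAtℕ-fromℕ< (Finₚ.toℕ<n z)) (cong letterAt (Finₚ.fromℕ<-toℕ z _))

    move : Subst → ℕ → Fin states → Fin states
    move f m s = δ̂ s (f (letterAtℕ m))

    gap : Subst → ℕ → ℕ → Fin states → Fin states
    gap f = between (move f)

    gap-cong : ∀ {f g} → f ≗ g → ∀ x y p → gap f x y p ≡ gap g x y p
    gap-cong f≗g x y p = between-cong x y p λ m _ _ s → cong (δ̂ s) (f≗g (letterAtℕ m))

    gap-≟-split : ∀ f p q {X Y} e → X < toℕ e → toℕ e < Y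
                → any (λ s → isYes (gap f X (toℕ e) p ≟ s) ∧ isYes (gap f (toℕ e) Y (δ̂ s (f (letterAt e))) ≟ q))
                      (allFin states)
                  ≡ isYes (gap f X Y p ≟ q)
    gap-≟-split f p q {X} {Y} e X<e e<Y = begin
      any (λ s → isYes (gap f X E p ≟ s) ∧ isYes (gap f E Y (δ̂ s (f (letterAt e))) ≟ q)) (allFin states)
        ≡⟨ any-select (λ s → isYes (gap f E Y (δ̂ s (f (letterAt e))) ≟ q)) (gap f X E p) ⟩
      isYes (gap f E Y (δ̂ (gap f X E p) (f (letterAt e))) ≟ q)
        ≡⟨ cong (λ c → isYes (gap f E Y (δ̂ (gap f X E p) (f c)) ≟ q)) (letterAtℕ-toℕ e) ⟨
      isYes (gap f E Y (move f E (gap f X E p)) ≟ q)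
        ≡⟨ cong (λ t → isYes (t ≟ q)) (between-split (move f) p X<e e<Y) ⟨
      isYes (gap f X Y p ≟ q) ∎
      where
      open ≡-Reasoning
      E : ℕ
      E = toℕ e

    intended : Aux arity n
    intended zero    _             = accepts D (word I)
    intended (suc j) (x ∷ y ∷ []) = isYes (gap (substOf j) (toℕ x) (toℕ y) (sourceOf j) ≟ targetOf j)

    accepts-word : Valid I → accepts D (word I) ≡ accept (iterateFrom (move id) 0 (suc n) start)
    accepts-word valid = cong accept (trans
      (foldl-concatMap δ (λ z → filterᵇ (λ σ → I σ z) (allFin k)) start (allFin (suc n)))
      (foldl-tabulate _ id (move id) 0 start λ z s → begin
        δ̂ s (letterAtℕ (toℕ z))                           ≡⟨ cong (δ̂ s) (letterAtℕ-toℕ z) ⟩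
        δ̂ s (letterAt z)                                  ≡⟨ foldl-letters s (letterAt z) ⟨
        foldl δ s (List.map id (letters (letterAt z)))
          ≡⟨ cong (foldl δ s) (filterᵇ-tabulate (λ σ → I σ z) id (valid z)) ⟨
        foldl δ s (filterᵇ (λ σ → I σ z) (allFin k))      ∎))
      where
      open ≡-Reasoning
      foldl-letters : ∀ s c → foldl δ s (List.map id (letters c)) ≡ δ̂ s c
      foldl-letters s zero    = refl
      foldl-letters s (suc σ) = refl

  module Update (ρ : ReplQuery k) (w : ℕ) where

    r : ℕ
    r = ReplQuery.params ρ

    Formula : Set
    Formula = QF k arity (r + w)

    param : Fin r → Term (r + w)
    param i = var (i Fin.↑ˡ w)

    anchorTerm : Anchor r → Term (r + w)
    anchorTerm (parameter i) = param i
    anchorTerm first         = min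
    anchorTerm last          = max

    roleTerm : Term (r + w) → Role r → Term (r + w)
    roleTerm t (anchor α) = anchorTerm α
    roleTerm t point      = t

    atTerm : Term (r + w) → Atoms k r arity (r + w)
    atTerm t = record
      { equal = λ u u′ → roleTerm t u ==' roleTerm t u′
      ; less  = λ u u′ → roleTerm t u <' roleTerm t u′
      ; holds = λ σ u → R σ (roleTerm t u)
      }

    -- sides i = true: parameter i lies at or before the current piece, false: at or after it
    Sides : Set
    Sides = Fin r → Bool

    _[_]≔_ : Sides → Fin r → Bool → Sides
    sides [ e ]≔ b = updateAt sides e (λ _ → b)

    -- Placed ignores the sides of the parameters still to be placed, so any value will do
    unplaced : Sides
    unplaced _ = true

    leftOf : Sides → Anchor r → Bool
    leftOf sides (parameter i) = sides i
    leftOf sides first         = true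
    leftOf sides last          = false

    -- z lies strictly between two consecutive anchors: it equals none of them and its order
    -- relative to each is given by the sides; R σ z is decided by the old letter c at z.
    inPiece : Sides → Letter → Atoms k r arity (r + w)
    inPiece sides c = record { equal = equal ; less = less ; holds = holds }
      where
      equal less : Role r → Role r → Formula
      equal point      point      = true'
      equal (anchor α) (anchor β) = anchorTerm α ==' anchorTerm β
      equal _          _          = ⊥ᶠ
      less point      point      = ⊥ᶠ
      less point      (anchor β) = constᶠ (not (leftOf sides β))
      less (anchor α) point      = constᶠ (leftOf sides α)
      less (anchor α) (anchor β) = anchorTerm α <' anchorTerm β
      holds : Fin k → Role r → Formula
      holds σ point      = constᶠ (isYes (c ≟ suc σ))
      holds σ (anchor α) = R σ (anchorTerm α)

    newLetterAt : Term (r + w) → Fin k → Formula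
    newLetterAt t σ = translate (atTerm t) (newRule ρ σ)

    pieceLetter : Sides → Letter → Fin k → Formula
    pieceLetter sides c σ = translate (inPiece sides c) (newRule ρ σ)

    gapᶠ : Sides → List (Fin r) → (x y : Term (r + w)) → Subst → (p q : Fin states) → Formula
    gapᶠ sides List.[] x y f p q =
      bindFirstEach (pieceLetter sides) λ h → aux T⟨ f ∘ h , p , q ⟩ (x ∷ y ∷ [])
    gapᶠ sides (e List.∷ es) x y f p q =
      ite (x <' param e)
        (ite (param e <' y)
          (⋁ λ s → gapᶠ (sides [ e ]≔ false) es x (param e) f p s
                 ∧' bindFirst (newLetterAt (param e)) λ c →
                      gapᶠ (sides [ e ]≔ true) es (param e) y f (δ̂ s (f c)) q)
          (gapᶠ (sides [ e ]≔ false) es x y f p q))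
        (gapᶠ (sides [ e ]≔ true) es x y f p q)

    acceptFrom : Fin states → Formula
    acceptFrom s₀ = ⋁ λ s → gapᶠ unplaced (allFin r) min max id s₀ s
                          ∧' bindFirst (newLetterAt max) (constᶠ ∘ accept ∘ δ̂ s)

    acceptAfter : Letter → Formula
    acceptAfter c = ite (min <' max) (acceptFrom (δ̂ start c)) (constᶠ (accept (δ̂ start c)))

    acceptᶠ : Formula
    acceptᶠ = bindFirst (newLetterAt min) acceptAfter

  module UpdateCorrect (ρ : ReplQuery k) (w : ℕ) {n : ℕ} (I : Input k n) (A : Aux arity n)
                       (a : Vec (Fin (suc n)) (ReplQuery.params ρ)) (bs : Vec (Fin (suc n)) w)
                       (valid : Valid I) (consistent : ∀ j us → A j us ≡ intended I j us) where
    open Update ρ w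
    open Eval I A (a ++ bs)

    I′ : Input k n
    I′ = applyρ ρ a I

    pos : Term (r + w) → ℕ
    pos t = toℕ (evalT (a ++ bs) t)

    N : ℕ
    N = toℕ (fromℕ n)

    evalT-anchor : ∀ α → evalT (a ++ bs) (anchorTerm α) ≡ anchorAt a α
    evalT-anchor (parameter i) = lookup-++ˡ a bs i
    evalT-anchor first         = refl
    evalT-anchor last          = refl

    atTerm-sound : ∀ t → Sound (atTerm t) I A (a ++ bs) a (evalT (a ++ bs) t)
    atTerm-sound t = record
      { equal-sound = λ u u′ → cong₂ (λ x y → isYes (x ≟ y)) (evalT-roleTerm u) (evalT-roleTerm u′)
      ; less-sound  = λ u u′ → cong₂ (λ x y → toℕ x <ᵇ toℕ y) (evalT-roleTerm u) (evalT-roleTerm u′)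
      ; holds-sound = λ σ u → cong (I σ) (evalT-roleTerm u)
      }
      where
      evalT-roleTerm : ∀ u → evalT (a ++ bs) (roleTerm t u) ≡ roleAt a (evalT (a ++ bs) t) u
      evalT-roleTerm (anchor α) = evalT-anchor α
      evalT-roleTerm point      = refl

    translate-newRule : ∀ {α} z → Sound α I A (a ++ bs) a z
                      → firstTrue (λ σ → ⟦ translate α (newRule ρ σ) ⟧) ≡ letterAt I′ z
    translate-newRule z sound = firstTrue-cong λ σ →
      trans (⟦translate⟧ _ I A (a ++ bs) a z sound (newRule ρ σ)) (eval-newRule ρ a I σ z)

    newLetterAt-correct : ∀ t → firstTrue (⟦_⟧ ∘ newLetterAt t) ≡ letterAt I′ (evalT (a ++ bs) t)
    newLetterAt-correct t = translate-newRule _ (atTerm-sound t)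

    Beside : Bool → ℕ → ℕ → Set
    Beside true  x z = x < z
    Beside false x z = z < x

    beside-≢ : ∀ b {x z : Fin (suc n)} → Beside b (toℕ x) (toℕ z) → z ≢ x
    beside-≢ true  x<z refl = ℕₚ.<-irrefl refl x<z
    beside-≢ false z<x refl = ℕₚ.<-irrefl refl z<x

    inPiece-sound : ∀ sides z → (∀ α → Beside (leftOf sides α) (toℕ (anchorAt a α)) (toℕ z))
                  → Sound (inPiece sides (letterAt I z)) I A (a ++ bs) a z
    inPiece-sound sides z beside =
      record { equal-sound = equal-sound ; less-sound = less-sound ; holds-sound = holds-sound }
      where
      open Atoms (inPiece sides (letterAt I z))
      equal-sound : ∀ u u′ → ⟦ equal u u′ ⟧ ≡ isYes (roleAt a z u ≟ roleAt a z u′)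
      equal-sound point      point      = sym (≟-refl z)
      equal-sound point      (anchor β) = sym (≟-≢ (beside-≢ (leftOf sides β) (beside β)))
      equal-sound (anchor α) point      = sym (≟-≢ (beside-≢ (leftOf sides α) (beside α) ∘ sym))
      equal-sound (anchor α) (anchor β) = cong₂ (λ x y → isYes (x ≟ y)) (evalT-anchor α) (evalT-anchor β)
      less-sound : ∀ u u′ → ⟦ less u u′ ⟧ ≡ (toℕ (roleAt a z u) <ᵇ toℕ (roleAt a z u′))
      less-sound point      point      = sym (≥⇒<ᵇ≡false {toℕ z} ℕₚ.≤-refl)
      less-sound point      (anchor β) with leftOf sides β | beside β
      ... | true  | β<z = sym (≥⇒<ᵇ≡false (ℕₚ.<⇒≤ β<z))
      ... | false | z<β = sym (<⇒<ᵇ≡true z<β)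
      less-sound (anchor α) point      with leftOf sides α | beside α
      ... | true  | α<z = sym (<⇒<ᵇ≡true α<z)
      ... | false | z<α = sym (≥⇒<ᵇ≡false (ℕₚ.<⇒≤ z<α))
      less-sound (anchor α) (anchor β) = cong₂ (λ x y → toℕ x <ᵇ toℕ y) (evalT-anchor α) (evalT-anchor β)
      holds-sound : ∀ σ u → ⟦ holds σ u ⟧ ≡ I σ (roleAt a z u)
      holds-sound σ point      = trans (⟦constᶠ⟧ _) (sym (firstTrue-unique (λ τ → I τ z) (valid z) σ))
      holds-sound σ (anchor α) = cong (I σ) (evalT-anchor α)

    pieceSubst : Sides → Subst
    pieceSubst sides c = firstTrue (⟦_⟧ ∘ pieceLetter sides c)

    Outside : Bool → ℕ → ℕ → ℕ → Set
    Outside true  p x y = p ≤ x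
    Outside false p x y = y ≤ p

    Placed : Sides → List (Fin r) → ℕ → ℕ → Set
    Placed sides es x y = ∀ i → i ∈ es ⊎ Outside (sides i) (pos (param i)) x y

    placed-≔ : ∀ {sides e es X Y X′ Y′} b → Placed sides (e List.∷ es) X Y
             → Outside b (pos (param e)) X′ Y′ → X ≤ X′ → Y′ ≤ Y → Placed (sides [ e ]≔ b) es X′ Y′
    placed-≔ {sides} {e} b placed outside X≤X′ Y′≤Y i with i ≟ e
    ... | yes refl = inj₂ (subst (λ b′ → Outside b′ _ _ _) (sym (updateAt-updates e sides)) outside)
    ... | no i≢e with placed i
    ...   | inj₁ (here i≡e)   = ⊥-elim (i≢e i≡e)
    ...   | inj₁ (there i∈es) = inj₁ i∈es
    ...   | inj₂ outside′     =
      inj₂ (subst (λ b′ → Outside b′ _ _ _) (sym (updateAt-minimal i e sides i≢e)) (shrink (sides i) outside′))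
      where
      shrink : ∀ b′ {p} → Outside b′ p _ _ → Outside b′ p _ _
      shrink true  p≤X = ℕₚ.≤-trans p≤X X≤X′
      shrink false Y≤p = ℕₚ.≤-trans Y′≤Y Y≤p

    placed⇒beside : ∀ sides {X Y} (z : Fin (suc n)) → Placed sides List.[] X Y → Y ≤ n
                  → X < toℕ z → toℕ z < Y → ∀ α → Beside (leftOf sides α) (toℕ (anchorAt a α)) (toℕ z)
    placed⇒beside sides z placed Y≤n X<z z<Y (parameter i) with placed i
    ... | inj₂ outside =
      subst (λ p → Beside (sides i) p (toℕ z)) (cong toℕ (evalT-anchor (parameter i))) (beside (sides i) outside)
      where
      beside : ∀ b {p} → Outside b p _ _ → Beside b p (toℕ z)
      beside true  p≤X = ℕₚ.≤-<-trans p≤X X<z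
      beside false Y≤p = ℕₚ.<-≤-trans z<Y Y≤p
    placed⇒beside sides z placed Y≤n X<z z<Y first = ℕₚ.≤-<-trans ℕ.z≤n X<z
    placed⇒beside sides z placed Y≤n X<z z<Y last  =
      subst (toℕ z <_) (sym (Finₚ.toℕ-fromℕ n)) (ℕₚ.<-≤-trans z<Y Y≤n)

    gap-piece : ∀ sides f {X Y} p → Placed sides List.[] X Y → Y ≤ n
              → gap I (f ∘ pieceSubst sides) X Y p ≡ gap I′ f X Y p
    gap-piece sides f {X} {Y} p placed Y≤n = between-cong X Y p λ m X<m m<Y s →
      cong (δ̂ s ∘ f) (new-letter (ℕₚ.m<n⇒m<1+n (ℕₚ.<-≤-trans m<Y Y≤n)) X<m m<Y)
      where
      new-letter : ∀ {m} (m<1+n : m < suc n) → X < m → m < Y → pieceSubst sides (letterAtℕ I m) ≡ letterAtℕ I′ m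
      new-letter m<1+n X<m m<Y rewrite letterAtℕ-fromℕ< I m<1+n | letterAtℕ-fromℕ< I′ m<1+n =
        translate-newRule z (inPiece-sound sides z beside)
        where
        z : Fin (suc n)
        z = fromℕ< m<1+n
        z≡m : toℕ z ≡ _
        z≡m = Finₚ.toℕ-fromℕ< m<1+n
        beside : ∀ α → Beside (leftOf sides α) (toℕ (anchorAt a α)) (toℕ z)
        beside = placed⇒beside sides z placed Y≤n (subst (X <_) (sym z≡m) X<m) (subst (_< Y) (sym z≡m) m<Y)

    ⟦T⟧ : ∀ g p q x y → ⟦ aux T⟨ g , p , q ⟩ (x ∷ y ∷ []) ⟧ ≡ isYes (gap I g (pos x) (pos y) p ≟ q)
    ⟦T⟧ g p q x y with decode g p q
    ... | g≗ , source , target = trans (consistent _ _) (cong₂ (λ s t → isYes (s ≟ t))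
            (trans (gap-cong I g≗ (pos x) (pos y) _) (cong (gap I g (pos x) (pos y)) source)) target)

    ⟦gapᶠ⟧ : ∀ sides es x y f p q → Placed sides es (pos x) (pos y)
           → ⟦ gapᶠ sides es x y f p q ⟧ ≡ isYes (gap I′ f (pos x) (pos y) p ≟ q)
    ⟦gapᶠ⟧ sides List.[] x y f p q placed = begin
      ⟦ bindFirstEach (pieceLetter sides) (λ h → aux T⟨ f ∘ h , p , q ⟩ (x ∷ y ∷ [])) ⟧
        ≡⟨ ⟦bindFirstEach⟧ (pieceLetter sides) (λ h → aux T⟨ f ∘ h , p , q ⟩ (x ∷ y ∷ []))
                           (λ h≗h′ → cong (λ j → A (suc j) _) (code-cong (cong f ∘ h≗h′) p q)) ⟩
      ⟦ aux T⟨ f ∘ pieceSubst sides , p , q ⟩ (x ∷ y ∷ []) ⟧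
        ≡⟨ ⟦T⟧ (f ∘ pieceSubst sides) p q x y ⟩
      isYes (gap I (f ∘ pieceSubst sides) (pos x) (pos y) p ≟ q)
        ≡⟨ cong (λ s → isYes (s ≟ q)) (gap-piece sides f p placed (ℕₚ.≤-pred (Finₚ.toℕ<n (evalT (a ++ bs) y)))) ⟩
      isYes (gap I′ f (pos x) (pos y) p ≟ q) ∎
      where open ≡-Reasoning
    ⟦gapᶠ⟧ sides (e List.∷ es) x y f p q placed with pos x <ᵇ pos (param e) in x<e
    ... | false = ⟦gapᶠ⟧ (sides [ e ]≔ true) es x y f p q
                    (placed-≔ true placed (<ᵇ≡false⇒≥ x<e) ℕₚ.≤-refl ℕₚ.≤-refl)
    -- a true guard of ite leaves a trailing ∨ false
    ... | true with pos (param e) <ᵇ pos y in e<y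
    ...   | false = trans (∨-identityʳ _) (⟦gapᶠ⟧ (sides [ e ]≔ false) es x y f p q
                      (placed-≔ false placed (<ᵇ≡false⇒≥ e<y) ℕₚ.≤-refl ℕₚ.≤-refl))
    ...   | true = trans (∨-identityʳ _) (trans (∨-identityʳ _) (begin
      ⟦ ⋁ (λ s → left s ∧' bindFirst (newLetterAt (param e)) (right s)) ⟧
        ≡⟨ ⟦⋁⟧ (λ s → left s ∧' bindFirst (newLetterAt (param e)) (right s)) ⟩
      any (λ s → ⟦ left s ⟧ ∧ ⟦ bindFirst (newLetterAt (param e)) (right s) ⟧) (allFin states)
        ≡⟨ any-cong (λ s → cong₂ _∧_ (⟦left⟧ s) (⟦right⟧ s)) (allFin states) ⟩
      any (λ s → isYes (gap I′ f X E p ≟ s) ∧ isYes (gap I′ f E Y (δ̂ s (f c)) ≟ q)) (allFin states)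
        ≡⟨ gap-≟-split I′ f p q (evalT (a ++ bs) (param e)) X<E E<Y ⟩
      isYes (gap I′ f X Y p ≟ q) ∎))
      where
      open ≡-Reasoning
      X E Y : ℕ
      X = pos x
      E = pos (param e)
      Y = pos y
      X<E : X < E
      X<E = <ᵇ≡true⇒< x<e
      E<Y : E < Y
      E<Y = <ᵇ≡true⇒< e<y
      c : Letter
      c = letterAt I′ (evalT (a ++ bs) (param e))
      left : Fin states → Formula
      left s = gapᶠ (sides [ e ]≔ false) es x (param e) f p s
      right : Fin states → Letter → Formula
      right s c′ = gapᶠ (sides [ e ]≔ true) es (param e) y f (δ̂ s (f c′)) q
      ⟦left⟧ : ∀ s → ⟦ left s ⟧ ≡ isYes (gap I′ f X E p ≟ s)
      ⟦left⟧ s = ⟦gapᶠ⟧ _ es x (param e) f p s (placed-≔ false placed ℕₚ.≤-refl ℕₚ.≤-refl (ℕₚ.<⇒≤ E<Y))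
      ⟦right⟧ : ∀ s → ⟦ bindFirst (newLetterAt (param e)) (right s) ⟧ ≡ isYes (gap I′ f E Y (δ̂ s (f c)) ≟ q)
      ⟦right⟧ s = begin
        ⟦ bindFirst (newLetterAt (param e)) (right s) ⟧
          ≡⟨ ⟦bindFirst⟧ (newLetterAt (param e)) (right s) ⟩
        ⟦ right s (firstTrue (⟦_⟧ ∘ newLetterAt (param e))) ⟧
          ≡⟨ cong (⟦_⟧ ∘ right s) (newLetterAt-correct (param e)) ⟩
        ⟦ right s c ⟧
          ≡⟨ ⟦gapᶠ⟧ _ es (param e) y f _ q (placed-≔ true placed ℕₚ.≤-refl (ℕₚ.<⇒≤ X<E) ℕₚ.≤-refl) ⟩
        isYes (gap I′ f E Y (δ̂ s (f c)) ≟ q) ∎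

    ⟦acceptFrom⟧ : ∀ s₀ → ⟦ acceptFrom s₀ ⟧ ≡ accept (move I′ id N (gap I′ id 0 N s₀))
    ⟦acceptFrom⟧ s₀ = begin
      ⟦ acceptFrom s₀ ⟧
        ≡⟨ ⟦⋁⟧ (λ s → middle s ∧' final s) ⟩
      any (λ s → ⟦ middle s ⟧ ∧ ⟦ final s ⟧) (allFin states)
        ≡⟨ any-cong (λ s → cong₂ _∧_ (⟦gapᶠ⟧ unplaced (allFin r) min max id s₀ s (inj₁ ∘ ∈-allFin)) (⟦final⟧ s))
                    (allFin states) ⟩
      any (λ s → isYes (gap I′ id 0 N s₀ ≟ s) ∧ accept (move I′ id N s)) (allFin states)
        ≡⟨ any-select (accept ∘ move I′ id N) (gap I′ id 0 N s₀) ⟩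
      accept (move I′ id N (gap I′ id 0 N s₀)) ∎
      where
      open ≡-Reasoning
      middle final : Fin states → Formula
      middle s = gapᶠ unplaced (allFin r) min max id s₀ s
      final s = bindFirst (newLetterAt max) (constᶠ ∘ accept ∘ δ̂ s)
      ⟦final⟧ : ∀ s → ⟦ final s ⟧ ≡ accept (move I′ id N s)
      ⟦final⟧ s = begin
        ⟦ final s ⟧
          ≡⟨ ⟦bindFirst⟧ (newLetterAt max) (constᶠ ∘ accept ∘ δ̂ s) ⟩
        ⟦ constᶠ (accept (δ̂ s (firstTrue (⟦_⟧ ∘ newLetterAt max)))) ⟧
          ≡⟨ ⟦constᶠ⟧ _ ⟩
        accept (δ̂ s (firstTrue (⟦_⟧ ∘ newLetterAt max)))
          ≡⟨ cong (accept ∘ δ̂ s) (trans (newLetterAt-correct max) (sym (letterAtℕ-toℕ I′ (fromℕ n)))) ⟩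
        accept (move I′ id N s) ∎

    ⟦acceptᶠ⟧ : Valid I′ → ⟦ acceptᶠ ⟧ ≡ accepts D (word I′)
    ⟦acceptᶠ⟧ valid′ = begin
      ⟦ acceptᶠ ⟧
        ≡⟨ ⟦bindFirst⟧ (newLetterAt min) acceptAfter ⟩
      ⟦ acceptAfter (firstTrue (⟦_⟧ ∘ newLetterAt min)) ⟧
        ≡⟨ cong (⟦_⟧ ∘ acceptAfter) (trans (newLetterAt-correct min) (sym (letterAtℕ-toℕ I′ zero))) ⟩
      ⟦ acceptAfter (letterAtℕ I′ 0) ⟧
        ≡⟨ ⟦ite⟧ (min <' max) (acceptFrom s₀) (constᶠ (accept s₀)) ⟩
      (if 0 <ᵇ N then ⟦ acceptFrom s₀ ⟧ else ⟦ constᶠ (accept s₀) ⟧)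
        ≡⟨ if-cong₂ (0 <ᵇ N) (⟦acceptFrom⟧ s₀) (⟦constᶠ⟧ _) ⟩
      (if 0 <ᵇ N then accept (move I′ id N (gap I′ id 0 N s₀)) else accept s₀)
        ≡⟨ if-float accept (0 <ᵇ N) ⟨
      accept (if 0 <ᵇ N then move I′ id N (gap I′ id 0 N s₀) else s₀)
        ≡⟨ cong accept (iterateFrom-whole (move I′ id) N start) ⟨
      accept (iterateFrom (move I′ id) 0 (suc N) start)
        ≡⟨ cong (λ m → accept (iterateFrom (move I′ id) 0 (suc m) start)) (Finₚ.toℕ-fromℕ n) ⟩
      accept (iterateFrom (move I′ id) 0 (suc n) start)
        ≡⟨ accepts-word I′ valid′ ⟨
      accepts D (word I′) ∎
      where
      open ≡-Reasoning
      s₀ : Fin states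
      s₀ = move I′ id 0 start

  program : (Δ : List (ReplQuery k)) → DynPropProg k Δ
  program Δ = record
    { m         = suc Code
    ; ar        = arity
    ; Q         = zero
    ; Q-nullary = refl
    ; update    = update
    ; init      = λ n → intended (emptyInput k n)
    }
    where
    update : (i : Fin (List.length Δ)) (T : Fin (suc Code))
           → QF k arity (ReplQuery.params (List.lookup Δ i) + arity T)
    update i zero    = Update.acceptᶠ (List.lookup Δ i) 0
    update i (suc j) =
      gapᶠ unplaced (allFin r) (var (r Fin.↑ʳ zero)) (var (r Fin.↑ʳ suc zero)) (substOf j) (sourceOf j) (targetOf j)
      where open Update (List.lookup Δ i) 2

  module _ (Δ : List (ReplQuery k)) (preserves : PreservesValidity Δ) where

    Consistent : ∀ {n} → State (program Δ) n → Set
    Consistent (I , A) = Valid I × (∀ j us → A j us ≡ intended I j us)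

    step-consistent : ∀ {n} (st : State (program Δ) n) c
                    → Consistent st → Consistent (step (program Δ) st c)
    step-consistent (I , A) (i , a) (valid , consistent) = valid′ , λ where
        zero    []             → UpdateCorrect.⟦acceptᶠ⟧ ρ 0 I A a [] valid consistent valid′
        (suc j) (x ∷ y ∷ []) → trans
          (UpdateCorrect.⟦gapᶠ⟧ ρ 2 I A a (x ∷ y ∷ []) valid consistent
             (Update.unplaced ρ 2) (allFin r) _ _ (substOf j) (sourceOf j) (targetOf j) (inj₁ ∘ ∈-allFin))
          (cong₂ (λ u v → isYes (gap (applyρ ρ a I) (substOf j) (toℕ u) (toℕ v) (sourceOf j) ≟ targetOf j))
                 (lookup-++ʳ a (x ∷ y ∷ []) zero) (lookup-++ʳ a (x ∷ y ∷ []) (suc zero)))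
      where
      ρ : ReplQuery k
      ρ = List.lookup Δ i
      r : ℕ
      r = ReplQuery.params ρ
      valid′ : Valid (applyρ ρ a I)
      valid′ = preserves i _ I a valid

    run-consistent : ∀ {n} cs → Consistent (run (program Δ) {n} cs)
    run-consistent {n} = go (emptyInput k n , intended (emptyInput k n)) ((λ _ _ _ ()) , λ _ _ → refl)
      where
      go : ∀ st → Consistent st → ∀ cs → Consistent (foldl (step (program Δ)) st cs)
      go st consistent List.[]         = consistent
      go st consistent (c List.∷ cs) = go (step (program Δ) st c) (step-consistent st c consistent) cs

theorem8 : (k : ℕ) (L : Language k) → Regular L
         → (Δ : List (ReplQuery k)) → PreservesValidity Δ
         → Σ (DynPropProg k Δ) λ P → Maintains P L
theorem8 k L (D , L⇔accepts) Δ preserves = program Δ , maintains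
  where
  open Construction D
  maintains : Maintains (program Δ) L
  maintains n c cs = mk⇔ (λ q → from (L⇔accepts _) (trans (sym Q≡accepts) q))
                          (λ w∈L → trans Q≡accepts (to (L⇔accepts _) w∈L))
    where
    Q≡accepts : Qval (program Δ) (run (program Δ) (c List.∷ cs))
              ≡ accepts D (word (proj₁ (run (program Δ) (c List.∷ cs))))
    Q≡accepts = proj₂ (run-consistent Δ preserves (c List.∷ cs)) zero []
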